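{- Let $(S,\mathcal B)$ be a Steiner triple system of order $21$ that contains a sub-TD$(3,6)$ and contains exactly one sub-STS$(9)$. Then $(S,\mathcal B)$ is not resolvable.
   Context: A Steiner triple system (STS) on $S$ is a set $\mathcal B$ of 3-subsets (blocks) of $S$ such that any two distinct points lie in exactly one block; STS$(v)$ means $|S|=v$. A sub-STS$(9)$ is a subset of $\mathcal B$ that is an STS on some 9-subset of $S$. A TD$(3,6)$ with groups $X,Y,Z$ (pairwise disjoint 6-sets) is a set of 3-subsets each meeting each group in exactly one point such that any two points from different groups lie in exactly one of them; a sub-TD$(3,6)$ of $\mathcal B$ is such a design contained in $\mathcal B$. The STS is resolvable if $\mathcal B$ can be partitioned into parallel classes, a parallel class being a set of blocks forming a partition of $S$. -}

module Defs where

open import Data.Nat using (ℕ)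
open import Data.Fin using (Fin)
open import Data.Fin.Subset using (Subset; _∈_; _⊆_; ∣_∣; ⊤)
open import Data.List using (List)
open import Data.List.Membership.Propositional renaming (_∈_ to _∈ₗ_)
open import Data.List.Relation.Unary.Unique.Propositional using (Unique)
open import Data.List.Relation.Unary.All using (All)
open import Data.List.Relation.Binary.Permutation.Propositional using (_↭_)
open import Data.Product using (Σ; ∃; _×_; ∃-syntax)
open import Data.Sum using (_⊎_)
open import Relation.Binary.PropositionalEquality using (_≡_)
open import Relation.Nullary using (¬_)

-- Points are Fin v; a block is a subset of Fin v; a collection of blocks
-- is a duplicate-free list of blocks (a finite set of blocks).

ExactlyOneBlock : ∀ {v} → List (Subset v) → Fin v → Fin v → Set
ExactlyOneBlock 𝓑 x y =
  ∃[ b ] (b ∈ₗ 𝓑 × x ∈ b × y ∈ b ×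
          (∀ b' → b' ∈ₗ 𝓑 → x ∈ b' → y ∈ b' → b' ≡ b))

IsSTSOn : ∀ {v} → Subset v → List (Subset v) → Set
IsSTSOn P 𝓑 =
  Unique 𝓑 ×
  All (λ b → ∣ b ∣ ≡ 3 × b ⊆ P) 𝓑 ×
  (∀ x y → x ∈ P → y ∈ P → ¬ x ≡ y → ExactlyOneBlock 𝓑 x y)

IsSTS : (v : ℕ) → List (Subset v) → Set
IsSTS v 𝓑 = IsSTSOn {v} ⊤ 𝓑

SubCollection : ∀ {v} → List (Subset v) → List (Subset v) → Set
SubCollection C 𝓑 = All (λ b → b ∈ₗ 𝓑) C

IsSubSTS9 : ∀ {v} → List (Subset v) → List (Subset v) → Set
IsSubSTS9 𝓑 C = SubCollection C 𝓑 × ∃[ P ] (∣ P ∣ ≡ 9 × IsSTSOn P C)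

-- 𝓑 contains exactly one sub-STS(9) (as a set of blocks, i.e. up to
-- reordering of the duplicate-free list)
ExactlyOneSubSTS9 : ∀ {v} → List (Subset v) → Set
ExactlyOneSubSTS9 𝓑 =
  ∃[ C ] (IsSubSTS9 𝓑 C × (∀ C' → IsSubSTS9 𝓑 C' → C' ↭ C))

IsTD36 : ∀ {v} → Subset v → Subset v → Subset v → List (Subset v) → Set
IsTD36 {v} X Y Z T =
  ∣ X ∣ ≡ 6 × ∣ Y ∣ ≡ 6 × ∣ Z ∣ ≡ 6 ×
  (∀ (x : Fin v) → ¬ (x ∈ X × x ∈ Y)) ×
  (∀ (x : Fin v) → ¬ (x ∈ X × x ∈ Z)) ×
  (∀ (x : Fin v) → ¬ (x ∈ Y × x ∈ Z)) ×
  Unique T ×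
  All (λ b → ∣ b ∣ ≡ 3 × OneIn b X × OneIn b Y × OneIn b Z) T ×
  (∀ x y → DifferentGroups x y → ExactlyOneBlock T x y)
  where
  OneIn : Subset v → Subset v → Set
  OneIn b G = ∃[ p ] (p ∈ b × p ∈ G × (∀ q → q ∈ b → q ∈ G → q ≡ p))
  DifferentGroups : Fin v → Fin v → Set
  DifferentGroups x y =
    (x ∈ X × y ∈ Y) ⊎ (x ∈ Y × y ∈ X) ⊎ (x ∈ X × y ∈ Z) ⊎
    (x ∈ Z × y ∈ X) ⊎ (x ∈ Y × y ∈ Z) ⊎ (x ∈ Z × y ∈ Y)

HasSubTD36 : ∀ {v} → List (Subset v) → Set
HasSubTD36 𝓑 =
  ∃[ X ] ∃[ Y ] ∃[ Z ] ∃[ T ] (SubCollection T 𝓑 × IsTD36 X Y Z T)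

-- 𝓑 is resolvable: there is a labelling of the blocks by class indices
-- (cls : Subset v → ℕ) such that, for every class index k that is used,
-- every point lies in exactly one block of 𝓑 with label k.
-- Then the classes {b ∈ 𝓑 | cls b ≡ k} partition 𝓑 into parallel classes.
Resolvable : ∀ {v} → List (Subset v) → Set
Resolvable {v} 𝓑 =
  Σ (Subset v → ℕ) λ cls → (∀ (k : ℕ) → (∃[ b ] (b ∈ₗ 𝓑 × cls b ≡ k)) →
     ∀ (x : Fin v) → ∃[ b ] (b ∈ₗ 𝓑 × cls b ≡ k × x ∈ b ×
        (∀ b' → b' ∈ₗ 𝓑 → cls b' ≡ k → x ∈ b' → b' ≡ b)))

module Submission where

-- Let W be the three points outside the groups X, Y, Z of the sub-TD(3,6).  If W
-- were a block, every G ∪ W (G a group) would carry a sub-STS(9), against uniqueness.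
-- Writing x · y for the third point of the block through x and y, the points
-- u · v (u ≠ v in W) therefore lie in groups.  For u ∈ W, x ↦ u · x is a
-- fixed-point-free involution on the points of a group other than the u · v, so,
-- groups having six points, all three points u · v lie in one group G g.  Let G h be
-- another group.  In a resolution the blocks through the three pairs of W lie in three
-- different parallel classes, and counting the transversal blocks of such a class
-- shows that it contains a block inside G h.  But for y ∈ G h the three points y · w
-- (w ∈ W) lie in G h, so y lies on at most one block inside G h: three such blocks
-- would need nine points of G h.

open import Defs
open import Data.Empty using (⊥; ⊥-elim)
open import Data.Fin using (Fin; zero; suc; #_)
open import Data.Fin.Properties using (_≟_) renaming (any? to ∃?)
open import Data.Fin.Subset
  using (Subset; Side; inside; outside; _∈_; _∉_; _⊆_; _∪_; _─_; _-_; ∁; ⁅_⁆; ∣_∣; Nonempty)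
open import Data.Fin.Subset.Properties
  using ( _∈?_; _⊆?_; nonempty?; Empty-unique; ∣⊥∣≡0; ∣∁p∣≡n∸∣p∣; p⊆q⇒∣p∣≤∣q∣; p─⊥≡p; p─q⊆p
        ; drop-∷-⊆; x∈⁅x⁆; x∈p∧x≢y⇒x∈p-y; x∈p∧x∉q⇒x∈p─q; x∈p∪q⁺; x∈p∪q⁻
        ; x∈p⇒x∉∁p; x∉∁p⇒x∈p; ∈⊤)
open import Data.List using (List; filter)
open import Data.List.Membership.Propositional using (find; lose) renaming (_∈_ to _∈ₗ_)
open import Data.List.Membership.Propositional.Properties using (∈-filter⁺; ∈-filter⁻)
open import Data.List.Relation.Binary.Permutation.Propositional using (↭-sym)
open import Data.List.Relation.Binary.Permutation.Propositional.Properties using (∈-resp-↭)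
import Data.List.Relation.Unary.All as All
open import Data.List.Relation.Unary.Any using (any?)
import Data.List.Relation.Unary.Unique.Propositional.Properties as Unique
open import Data.Nat using (ℕ; zero; suc; _+_; _∸_; _≤_; _≤?_; s≤s; z≤n)
open import Data.Nat.Divisibility using (_∣_; _∣?_; _∣0; ∣m∣n⇒∣m+n; ∣-refl)
open import Data.Nat.Properties using (+-suc; +-cancelʳ-≡; suc-injective; <-irrefl; module ≤-Reasoning)
  renaming (_≟_ to _≟ℕ_)
open import Data.Product using (∃-syntax; _×_; _,_; proj₁; proj₂)
open import Data.Sum using (_⊎_; inj₁; inj₂; swap; [_,_]′)
open import Data.Vec using ([]; _∷_; here; there)
open import Function using (_∘_)
open import Relation.Binary.PropositionalEquality
  using (_≡_; _≢_; refl; sym; trans; cong; cong₂; subst; subst₂; module ≡-Reasoning)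
open import Relation.Nullary using (¬_; yes; no; _×-dec_; ¬?; decidable-stable)
open import Relation.Nullary.Decidable using (from-no)

private variable
  n k : ℕ
  p q : Subset n
  x y z t w : Fin n

-- Counting in finite subsets

x∈p-y⇒x∈p : x ∈ p - y → x ∈ p
x∈p-y⇒x∈p {p = p} {y = y} = p─q⊆p p ⁅ y ⁆

x∈p─q⇒x∉q : x ∈ p ─ q → x ∉ q
x∈p─q⇒x∉q {p = _ ∷ _} {q = inside ∷ _} ()          here
x∈p─q⇒x∉q {p = _ ∷ _} {q = _ ∷ _}      (there x∈) (there x∈q) = x∈p─q⇒x∉q x∈ x∈q

x∈p-y⇒x≢y : x ∈ p - y → x ≢ y
x∈p-y⇒x≢y {y = y} x∈ refl = x∈p─q⇒x∉q x∈ (x∈⁅x⁆ y)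

drop-disjoint : ∀ {s t : Side} → (∀ {x} → x ∈ s ∷ p → x ∉ t ∷ q) → ∀ {x} → x ∈ p → x ∉ q
drop-disjoint p∩q≡∅ x∈p x∈q = p∩q≡∅ (there x∈p) (there x∈q)

∣p∪q∣≡∣p∣+∣q∣ : ∀ (p q : Subset n) → (∀ {x} → x ∈ p → x ∉ q) → ∣ p ∪ q ∣ ≡ ∣ p ∣ + ∣ q ∣
∣p∪q∣≡∣p∣+∣q∣ []            []            _     = refl
∣p∪q∣≡∣p∣+∣q∣ (inside  ∷ p) (inside  ∷ q) p∩q≡∅ = ⊥-elim (p∩q≡∅ here here)
∣p∪q∣≡∣p∣+∣q∣ (inside  ∷ p) (outside ∷ q) p∩q≡∅ = cong suc (∣p∪q∣≡∣p∣+∣q∣ p q (drop-disjoint p∩q≡∅))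
∣p∪q∣≡∣p∣+∣q∣ (outside ∷ p) (inside  ∷ q) p∩q≡∅ =
  trans (cong suc (∣p∪q∣≡∣p∣+∣q∣ p q (drop-disjoint p∩q≡∅))) (sym (+-suc ∣ p ∣ ∣ q ∣))
∣p∪q∣≡∣p∣+∣q∣ (outside ∷ p) (outside ∷ q) p∩q≡∅ = ∣p∪q∣≡∣p∣+∣q∣ p q (drop-disjoint p∩q≡∅)

q⊆p⇒∣p∣≡∣p─q∣+∣q∣ : ∀ (p q : Subset n) → q ⊆ p → ∣ p ∣ ≡ ∣ p ─ q ∣ + ∣ q ∣
q⊆p⇒∣p∣≡∣p─q∣+∣q∣ []            []            _   = refl
q⊆p⇒∣p∣≡∣p─q∣+∣q∣ (inside  ∷ p) (inside  ∷ q) q⊆p =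
  trans (cong suc (q⊆p⇒∣p∣≡∣p─q∣+∣q∣ p q (drop-∷-⊆ q⊆p))) (sym (+-suc ∣ p ─ q ∣ ∣ q ∣))
q⊆p⇒∣p∣≡∣p─q∣+∣q∣ (inside  ∷ p) (outside ∷ q) q⊆p = cong suc (q⊆p⇒∣p∣≡∣p─q∣+∣q∣ p q (drop-∷-⊆ q⊆p))
q⊆p⇒∣p∣≡∣p─q∣+∣q∣ (outside ∷ p) (inside  ∷ q) q⊆p with () ← q⊆p here
q⊆p⇒∣p∣≡∣p─q∣+∣q∣ (outside ∷ p) (outside ∷ q) q⊆p = q⊆p⇒∣p∣≡∣p─q∣+∣q∣ p q (drop-∷-⊆ q⊆p)

x∈p⇒∣p∣≡1+∣p-x∣ : x ∈ p → ∣ p ∣ ≡ suc ∣ p - x ∣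
x∈p⇒∣p∣≡1+∣p-x∣ {p = inside  ∷ p} here        = cong (λ r → suc ∣ r ∣) (sym (p─⊥≡p p))
x∈p⇒∣p∣≡1+∣p-x∣ {p = inside  ∷ p} (there x∈p) = cong suc (x∈p⇒∣p∣≡1+∣p-x∣ x∈p)
x∈p⇒∣p∣≡1+∣p-x∣ {p = outside ∷ p} (there x∈p) = x∈p⇒∣p∣≡1+∣p-x∣ x∈p

∣p-x∣≡k : x ∈ p → ∣ p ∣ ≡ suc k → ∣ p - x ∣ ≡ k
∣p-x∣≡k x∈p ∣p∣≡1+k = suc-injective (trans (sym (x∈p⇒∣p∣≡1+∣p-x∣ x∈p)) ∣p∣≡1+k)

∣p∣≡0⇒x∉p : ∣ p ∣ ≡ 0 → x ∉ p
∣p∣≡0⇒x∉p ∣p∣≡0 x∈p with () ← trans (sym ∣p∣≡0) (x∈p⇒∣p∣≡1+∣p-x∣ x∈p)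

-- The existence lemmas below are opaque: their witnesses are found by exhaustive
-- search, which should never be unfolded when their results are used.
opaque
  ∣p∣≡1+k⇒nonempty : ∀ {p : Subset n} → ∣ p ∣ ≡ suc k → Nonempty p
  ∣p∣≡1+k⇒nonempty {n} {p = p} ∣p∣≡1+k with nonempty? p
  ... | yes ne = ne
  ... | no ¬ne with () ← trans (sym ∣p∣≡1+k) (trans (cong ∣_∣ (Empty-unique ¬ne)) (∣⊥∣≡0 n))

opaque
  ∣p∣≡2+k⇒second : x ∈ p → ∣ p ∣ ≡ suc (suc k) → ∃[ y ] (y ∈ p × y ≢ x)
  ∣p∣≡2+k⇒second {p = p} x∈p ∣p∣≡2+k with y , y∈p-x ← ∣p∣≡1+k⇒nonempty (∣p-x∣≡k x∈p ∣p∣≡2+k) =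
    y , x∈p-y⇒x∈p {p = p} y∈p-x , x∈p-y⇒x≢y {p = p} y∈p-x

opaque
  ∣p∣≡3⇒third : ∣ p ∣ ≡ 3 → x ∈ p → y ∈ p → x ≢ y → ∃[ z ] (z ∈ p × z ≢ x × z ≢ y)
  ∣p∣≡3⇒third {p = p} {x = x} ∣p∣≡3 x∈p y∈p x≢y
    with z , z∈p-x-y ← ∣p∣≡1+k⇒nonempty (∣p-x∣≡k (x∈p∧x≢y⇒x∈p-y y∈p (x≢y ∘ sym)) (∣p-x∣≡k x∈p ∣p∣≡3)) =
    z , x∈p-y⇒x∈p {p = p} (x∈p-y⇒x∈p {p = p - x} z∈p-x-y) ,
    x∈p-y⇒x≢y {p = p} (x∈p-y⇒x∈p {p = p - x} z∈p-x-y) , x∈p-y⇒x≢y {p = p - x} z∈p-x-y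

opaque
  p⊈q⇒∃∉ : ¬ p ⊆ q → ∃[ x ] (x ∈ p × x ∉ q)
  p⊈q⇒∃∉ {p = p} {q = q} p⊈q with ∃? (λ x → x ∈? p ×-dec ¬? (x ∈? q))
  ... | yes x∈p─q = x∈p─q
  ... | no  ∄ = ⊥-elim (p⊈q λ {x} x∈p → decidable-stable (x ∈? q) (λ x∉q → ∄ (x , x∈p , x∉q)))

∣p∣≡1⇒x≡y : ∣ p ∣ ≡ 1 → x ∈ p → y ∈ p → x ≡ y
∣p∣≡1⇒x≡y {x = x} {y = y} ∣p∣≡1 x∈p y∈p with x ≟ y
... | yes x≡y = x≡y
... | no  x≢y = ⊥-elim (∣p∣≡0⇒x∉p (∣p-x∣≡k x∈p ∣p∣≡1) (x∈p∧x≢y⇒x∈p-y y∈p (x≢y ∘ sym)))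

∣p∣≡3⇒⊆⁅x,y,z⁆ : ∣ p ∣ ≡ 3 → x ∈ p → y ∈ p → z ∈ p → x ≢ y → x ≢ z → y ≢ z →
  t ∈ p → t ≡ x ⊎ t ≡ y ⊎ t ≡ z
∣p∣≡3⇒⊆⁅x,y,z⁆ {p = p} {x = x} {y = y} {t = t} ∣p∣≡3 x∈p y∈p z∈p x≢y x≢z y≢z t∈p with t ≟ x | t ≟ y
... | yes t≡x | _       = inj₁ t≡x
... | no  _   | yes t≡y = inj₂ (inj₁ t≡y)
... | no  t≢x | no  t≢y =
  inj₂ (inj₂ (∣p∣≡1⇒x≡y ∣p-x-y∣≡1 (∈p-x-y t∈p t≢x t≢y) (∈p-x-y z∈p (x≢z ∘ sym) (y≢z ∘ sym))))
  where
  ∣p-x-y∣≡1 : ∣ p - x - y ∣ ≡ 1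
  ∣p-x-y∣≡1 = ∣p-x∣≡k (x∈p∧x≢y⇒x∈p-y y∈p (x≢y ∘ sym)) (∣p-x∣≡k x∈p ∣p∣≡3)
  ∈p-x-y : ∀ {s} → s ∈ p → s ≢ x → s ≢ y → s ∈ p - x - y
  ∈p-x-y s∈p s≢x s≢y = x∈p∧x≢y⇒x∈p-y (x∈p∧x≢y⇒x∈p-y s∈p s≢x) s≢y

injection⇒∣p∣≤∣q∣ : ∀ {m} {p : Subset n} {q : Subset m} (f : ∀ {x} → x ∈ p → Fin m) →
  (∀ {x} (x∈p : x ∈ p) → f x∈p ∈ q) →
  (∀ {x y} (x∈p : x ∈ p) (y∈p : y ∈ p) → f x∈p ≡ f y∈p → x ≡ y) →
  ∣ p ∣ ≤ ∣ q ∣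
injection⇒∣p∣≤∣q∣ {n} {m} f f∈q f-inj = go _ refl f f∈q f-inj
  where
  open ≤-Reasoning
  go : ∀ k {p : Subset n} {q : Subset m} → ∣ p ∣ ≡ k → (f : ∀ {x} → x ∈ p → Fin m) →
    (∀ {x} (x∈p : x ∈ p) → f x∈p ∈ q) →
    (∀ {x y} (x∈p : x ∈ p) (y∈p : y ∈ p) → f x∈p ≡ f y∈p → x ≡ y) →
    ∣ p ∣ ≤ ∣ q ∣
  go zero    ∣p∣≡0 _ _ _ = subst (_≤ _) (sym ∣p∣≡0) z≤n
  go (suc k) {p} {q} ∣p∣≡1+k f f∈q f-inj with x , x∈p ← ∣p∣≡1+k⇒nonempty ∣p∣≡1+k = begin
    ∣ p ∣              ≡⟨ x∈p⇒∣p∣≡1+∣p-x∣ x∈p ⟩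
    suc ∣ p - x ∣      ≤⟨ s≤s (go k (∣p-x∣≡k x∈p ∣p∣≡1+k) f′ f′∈q-fx (λ _ _ → f-inj _ _)) ⟩
    suc ∣ q - f x∈p ∣  ≡⟨ sym (x∈p⇒∣p∣≡1+∣p-x∣ (f∈q x∈p)) ⟩
    ∣ q ∣              ∎
    where
    f′ : ∀ {y} → y ∈ p - x → Fin m
    f′ y∈ = f (x∈p-y⇒x∈p y∈)
    f′∈q-fx : ∀ {y} (y∈ : y ∈ p - x) → f′ y∈ ∈ q - f x∈p
    f′∈q-fx y∈ = x∈p∧x≢y⇒x∈p-y (f∈q _) (x∈p-y⇒x≢y y∈ ∘ f-inj _ _)

pigeonhole : ∀ {m} {p : Subset n} {q : Subset m} → ∣ p ∣ ≡ suc k → ∣ q ∣ ≡ k →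
  (f : ∀ {x} → x ∈ p → Fin m) →
  (∀ {x} (x∈p : x ∈ p) → f x∈p ∈ q) →
  (∀ {x y} (x∈p : x ∈ p) (y∈p : y ∈ p) → f x∈p ≡ f y∈p → x ≡ y) →
  ⊥
pigeonhole ∣p∣≡1+k ∣q∣≡k f f∈q f-inj =
  <-irrefl refl (subst₂ _≤_ ∣p∣≡1+k ∣q∣≡k (injection⇒∣p∣≤∣q∣ f f∈q f-inj))

involution⇒2∣∣p∣ : ∀ {p : Subset n} (σ : Fin n → Fin n) →
  (∀ {x} → x ∈ p → σ x ∈ p) → (∀ {x} → x ∈ p → σ x ≢ x) → (∀ {x} → x ∈ p → σ (σ x) ≡ x) →
  2 ∣ ∣ p ∣
involution⇒2∣∣p∣ {n} σ = go _ refl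
  where
  go : ∀ k {p : Subset n} → ∣ p ∣ ≡ k →
    (∀ {x} → x ∈ p → σ x ∈ p) → (∀ {x} → x ∈ p → σ x ≢ x) → (∀ {x} → x ∈ p → σ (σ x) ≡ x) →
    2 ∣ ∣ p ∣
  go zero ∣p∣≡0 _ _ _ = subst (2 ∣_) (sym ∣p∣≡0) (2 ∣0)
  go (suc k) {p} ∣p∣≡1+k σ∈p σx≢x σσx≡x with x , x∈p ← ∣p∣≡1+k⇒nonempty ∣p∣≡1+k =
    remove-pair k (∣p-x∣≡k x∈p ∣p∣≡1+k)
    where
    σx∈p-x : σ x ∈ p - x
    σx∈p-x = x∈p∧x≢y⇒x∈p-y (σ∈p x∈p) (σx≢x x∈p)
    p′ : Subset n
    p′ = p - x - σ x
    p′⊆p : ∀ {y} → y ∈ p′ → y ∈ p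
    p′⊆p = x∈p-y⇒x∈p ∘ x∈p-y⇒x∈p
    σ∈p′ : ∀ {y} → y ∈ p′ → σ y ∈ p′
    σ∈p′ {y} y∈p′ = x∈p∧x≢y⇒x∈p-y (x∈p∧x≢y⇒x∈p-y (σ∈p (p′⊆p y∈p′)) σy≢x) σy≢σx
      where
      σy≢x : σ y ≢ x
      σy≢x σy≡x = x∈p-y⇒x≢y y∈p′ (trans (sym (σσx≡x (p′⊆p y∈p′))) (cong σ σy≡x))
      σy≢σx : σ y ≢ σ x
      σy≢σx σy≡σx = x∈p-y⇒x≢y (x∈p-y⇒x∈p y∈p′)
        (trans (sym (σσx≡x (p′⊆p y∈p′))) (trans (cong σ σy≡σx) (σσx≡x x∈p)))
    remove-pair : ∀ k → ∣ p - x ∣ ≡ k → 2 ∣ ∣ p ∣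
    remove-pair zero    ∣p-x∣≡0 = ⊥-elim (∣p∣≡0⇒x∉p ∣p-x∣≡0 σx∈p-x)
    remove-pair (suc k) ∣p-x∣≡1+k =
      subst (2 ∣_) (sym (trans (x∈p⇒∣p∣≡1+∣p-x∣ x∈p) (cong suc (x∈p⇒∣p∣≡1+∣p-x∣ σx∈p-x))))
        (∣m∣n⇒∣m+n ∣-refl (go k (∣p-x∣≡k σx∈p-x ∣p-x∣≡1+k) σ∈p′ (σx≢x ∘ p′⊆p) (σσx≡x ∘ p′⊆p)))

-- Steiner triple systems as Steiner quasigroups

module SteinerTripleSystem {v} {𝓑 : List (Subset v)} (sts : IsSTS v 𝓑) where

  private variable
    b b₁ b₂ : Subset v

  ∣b∣≡3 : b ∈ₗ 𝓑 → ∣ b ∣ ≡ 3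
  ∣b∣≡3 b∈𝓑 = let _ , all-triples , _ = sts in proj₁ (All.lookup all-triples b∈𝓑)

  block-unique : b₁ ∈ₗ 𝓑 → b₂ ∈ₗ 𝓑 → x ≢ y → x ∈ b₁ → y ∈ b₁ → x ∈ b₂ → y ∈ b₂ → b₁ ≡ b₂
  block-unique b₁∈𝓑 b₂∈𝓑 x≢y x∈b₁ y∈b₁ x∈b₂ y∈b₂ =
    let _ , _ , covers = sts
        _ , _ , _ , _ , unique = covers _ _ ∈⊤ ∈⊤ x≢y
    in trans (unique _ b₁∈𝓑 x∈b₁ y∈b₁) (sym (unique _ b₂∈𝓑 x∈b₂ y∈b₂))

  line : x ≢ y → ∃[ b ] (b ∈ₗ 𝓑 × x ∈ b × y ∈ b)
  line x≢y = let _ , _ , covers = sts ; b , b∈𝓑 , x∈b , y∈b , _ = covers _ _ ∈⊤ ∈⊤ x≢y in b , b∈𝓑 , x∈b , y∈b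

  private
    third : (x≢y : x ≢ y) → ∃[ z ] (z ∈ proj₁ (line x≢y) × z ≢ x × z ≢ y)
    third x≢y = let _ , b∈𝓑 , x∈b , y∈b = line x≢y in ∣p∣≡3⇒third (∣b∣≡3 b∈𝓑) x∈b y∈b x≢y

  -- x · x = x is a junk value: every lemma about x · y assumes x ≢ y.
  infixl 7 _·_
  _·_ : Fin v → Fin v → Fin v
  x · y with x ≟ y
  ... | yes _   = x
  ... | no x≢y = proj₁ (third x≢y)

  ·-line : x ≢ y → x · y ≢ x × x · y ≢ y × ∃[ b ] (b ∈ₗ 𝓑 × x ∈ b × y ∈ b × x · y ∈ b)
  ·-line {x} {y} x≢y with x ≟ y
  ... | yes x≡y = ⊥-elim (x≢y x≡y)
  ... | no x≢y′ =
    let _ , b∈𝓑 , x∈b , y∈b = line x≢y′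
        _ , z∈b , z≢x , z≢y = third x≢y′
    in z≢x , z≢y , _ , b∈𝓑 , x∈b , y∈b , z∈b

  ·≢ˡ : x ≢ y → x · y ≢ x
  ·≢ˡ x≢y = proj₁ (·-line x≢y)

  ·≢ʳ : x ≢ y → x · y ≢ y
  ·≢ʳ x≢y = proj₁ (proj₂ (·-line x≢y))

  ·∈ : b ∈ₗ 𝓑 → x ∈ b → y ∈ b → x ≢ y → x · y ∈ b
  ·∈ b∈𝓑 x∈b y∈b x≢y =
    let _ , _ , _ , b′∈𝓑 , x∈b′ , y∈b′ , x·y∈b′ = ·-line x≢y
    in subst (_ ∈_) (block-unique b′∈𝓑 b∈𝓑 x≢y x∈b′ y∈b′ x∈b y∈b) x·y∈b′

  ∈⇒≡∨≡∨≡· : b ∈ₗ 𝓑 → x ∈ b → y ∈ b → x ≢ y → t ∈ b → t ≡ x ⊎ t ≡ y ⊎ t ≡ x · y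
  ∈⇒≡∨≡∨≡· b∈𝓑 x∈b y∈b x≢y =
    ∣p∣≡3⇒⊆⁅x,y,z⁆ (∣b∣≡3 b∈𝓑) x∈b y∈b (·∈ b∈𝓑 x∈b y∈b x≢y) x≢y (·≢ˡ x≢y ∘ sym) (·≢ʳ x≢y ∘ sym)

  ·-comm : x ≢ y → x · y ≡ y · x
  ·-comm x≢y with _ , _ , _ , b∈𝓑 , x∈b , y∈b , _ ← ·-line x≢y
    with ∈⇒≡∨≡∨≡· b∈𝓑 x∈b y∈b x≢y (·∈ b∈𝓑 y∈b x∈b (x≢y ∘ sym))
  ... | inj₁ y·x≡x          = ⊥-elim (·≢ʳ (x≢y ∘ sym) y·x≡x)
  ... | inj₂ (inj₁ y·x≡y)   = ⊥-elim (·≢ˡ (x≢y ∘ sym) y·x≡y)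
  ... | inj₂ (inj₂ y·x≡x·y) = sym y·x≡x·y

  ·-involutive : x ≢ y → x · (x · y) ≡ y
  ·-involutive x≢y with _ , _ , _ , b∈𝓑 , x∈b , y∈b , x·y∈b ← ·-line x≢y
    with ∈⇒≡∨≡∨≡· b∈𝓑 x∈b y∈b x≢y (·∈ b∈𝓑 x∈b x·y∈b (·≢ˡ x≢y ∘ sym))
  ... | inj₁ x·x·y≡x        = ⊥-elim (·≢ˡ (·≢ˡ x≢y ∘ sym) x·x·y≡x)
  ... | inj₂ (inj₁ x·x·y≡y) = x·x·y≡y
  ... | inj₂ (inj₂ x·x·y≡x·y) = ⊥-elim (·≢ʳ (·≢ˡ x≢y ∘ sym) x·x·y≡x·y)

  ·-cancelˡ : x ≢ y → x ≢ z → x · y ≡ x · z → y ≡ z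
  ·-cancelˡ {x} x≢y x≢z x·y≡x·z =
    trans (sym (·-involutive x≢y)) (trans (cong (x ·_) x·y≡x·z) (·-involutive x≢z))

  ·∈⇒∈ : b ∈ₗ 𝓑 → x ∈ b → x · y ∈ b → x ≢ y → y ∈ b
  ·∈⇒∈ b∈𝓑 x∈b x·y∈b x≢y =
    subst (_∈ _) (·-involutive x≢y) (·∈ b∈𝓑 x∈b x·y∈b (·≢ˡ x≢y ∘ sym))

  closed⇒IsSTSOn : ∀ {P} → (∀ {x y} → x ∈ P → y ∈ P → x ≢ y → x · y ∈ P) →
    IsSTSOn P (filter (_⊆? P) 𝓑)
  closed⇒IsSTSOn {P} closed =
    Unique.filter⁺ (_⊆? P) (proj₁ sts) ,
    All.tabulate (λ b∈ → let b∈𝓑 , b⊆P = ∈-filter⁻ (_⊆? P) b∈ in ∣b∣≡3 b∈𝓑 , b⊆P) ,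
    covers
    where
    covers : ∀ x y → x ∈ P → y ∈ P → ¬ x ≡ y → ExactlyOneBlock (filter (_⊆? P) 𝓑) x y
    covers x y x∈P y∈P x≢y with b , b∈𝓑 , x∈b , y∈b ← line x≢y =
      b , ∈-filter⁺ (_⊆? P) b∈𝓑 b⊆P , x∈b , y∈b ,
      λ b′ b′∈ x∈b′ y∈b′ → block-unique (proj₁ (∈-filter⁻ (_⊆? P) b′∈)) b∈𝓑 x≢y x∈b′ y∈b′ x∈b y∈b
      where
      b⊆P : b ⊆ P
      b⊆P t∈b with ∈⇒≡∨≡∨≡· b∈𝓑 x∈b y∈b x≢y t∈b
      ... | inj₁ refl        = x∈P
      ... | inj₂ (inj₁ refl) = y∈P
      ... | inj₂ (inj₂ refl) = closed x∈P y∈P x≢y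

-- Parallel classes of a resolution

module ParallelClasses {v} {𝓑 : List (Subset v)} (resolution : Resolvable 𝓑) where

  cls : Subset v → ℕ
  cls = proj₁ resolution

  module Class {b₀ : Subset v} (b₀∈𝓑 : b₀ ∈ₗ 𝓑) where

    private
      partition : ∀ x → ∃[ b ] (b ∈ₗ 𝓑 × cls b ≡ cls b₀ × x ∈ b ×
                                (∀ b′ → b′ ∈ₗ 𝓑 → cls b′ ≡ cls b₀ → x ∈ b′ → b′ ≡ b))
      partition = proj₂ resolution (cls b₀) (b₀ , b₀∈𝓑 , refl)

    through : Fin v → Subset v
    through x = proj₁ (partition x)

    through∈𝓑 : through x ∈ₗ 𝓑
    through∈𝓑 {x = x} = let _ , b∈𝓑 , _ = partition x in b∈𝓑

    cls-through : cls (through x) ≡ cls b₀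
    cls-through {x = x} = let _ , _ , cls-b , _ = partition x in cls-b

    x∈through : x ∈ through x
    x∈through {x = x} = let _ , _ , _ , x∈b , _ = partition x in x∈b

    through-unique : ∀ {b} → b ∈ₗ 𝓑 → cls b ≡ cls b₀ → x ∈ b → b ≡ through x
    through-unique {x = x} = let _ , _ , _ , _ , unique = partition x in unique _

    through-cong : x ∈ through y → through x ≡ through y
    through-cong x∈ = sym (through-unique through∈𝓑 cls-through x∈)

  same-class⇒≡ : ∀ {b₁ b₂} → b₁ ∈ₗ 𝓑 → b₂ ∈ₗ 𝓑 → cls b₁ ≡ cls b₂ → x ∈ b₁ → x ∈ b₂ → b₁ ≡ b₂
  same-class⇒≡ b₁∈𝓑 b₂∈𝓑 cls≡ x∈b₁ x∈b₂ =
    trans (through-unique b₁∈𝓑 refl x∈b₁) (sym (through-unique b₂∈𝓑 (sym cls≡) x∈b₂))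
    where open Class b₁∈𝓑

-- An STS(21) containing a TD(3,6)

module Configuration {𝓑 : List (Subset 21)} (sts : IsSTS 21 𝓑)
  {X Y Z : Subset 21} {T : List (Subset 21)} (T⊆𝓑 : SubCollection T 𝓑) (td : IsTD36 X Y Z T) where

  open SteinerTripleSystem sts

  private variable
    b : Subset 21
    g h : Fin 3

  G : Fin 3 → Subset 21
  G zero             = X
  G (suc zero)       = Y
  G (suc (suc zero)) = Z

  W : Subset 21
  W = ∁ (X ∪ (Y ∪ Z))

  ∣G∣≡6 : ∀ g → ∣ G g ∣ ≡ 6
  ∣G∣≡6 zero             = let ∣X∣≡6 , _ = td in ∣X∣≡6
  ∣G∣≡6 (suc zero)       = let _ , ∣Y∣≡6 , _ = td in ∣Y∣≡6
  ∣G∣≡6 (suc (suc zero)) = let _ , _ , ∣Z∣≡6 , _ = td in ∣Z∣≡6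

  G-disjoint : g ≢ h → x ∈ G g → x ∉ G h
  G-disjoint {zero}           {zero}           g≢h _   _   = g≢h refl
  G-disjoint {zero}           {suc zero}       _   x∈X x∈Y = let _ , _ , _ , X∩Y , _ = td in X∩Y _ (x∈X , x∈Y)
  G-disjoint {zero}           {suc (suc zero)} _   x∈X x∈Z = let _ , _ , _ , _ , X∩Z , _ = td in X∩Z _ (x∈X , x∈Z)
  G-disjoint {suc zero}       {zero}           _   x∈Y x∈X = let _ , _ , _ , X∩Y , _ = td in X∩Y _ (x∈X , x∈Y)
  G-disjoint {suc zero}       {suc zero}       g≢h _   _   = g≢h refl
  G-disjoint {suc zero}       {suc (suc zero)} _   x∈Y x∈Z = let _ , _ , _ , _ , _ , Y∩Z , _ = td in Y∩Z _ (x∈Y , x∈Z)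
  G-disjoint {suc (suc zero)} {zero}           _   x∈Z x∈X = let _ , _ , _ , _ , X∩Z , _ = td in X∩Z _ (x∈X , x∈Z)
  G-disjoint {suc (suc zero)} {suc zero}       _   x∈Z x∈Y = let _ , _ , _ , _ , _ , Y∩Z , _ = td in Y∩Z _ (x∈Y , x∈Z)
  G-disjoint {suc (suc zero)} {suc (suc zero)} g≢h _   _   = g≢h refl

  G≢G⇒≢ : g ≢ h → x ∈ G g → y ∈ G h → x ≢ y
  G≢G⇒≢ g≢h x∈G y∈G refl = G-disjoint g≢h x∈G y∈G

  G⇒∉W : x ∈ G g → x ∉ W
  G⇒∉W {g = zero}           x∈X = x∈p⇒x∉∁p (x∈p∪q⁺ (inj₁ x∈X))
  G⇒∉W {g = suc zero}       x∈Y = x∈p⇒x∉∁p (x∈p∪q⁺ (inj₂ (x∈p∪q⁺ (inj₁ x∈Y))))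
  G⇒∉W {g = suc (suc zero)} x∈Z = x∈p⇒x∉∁p (x∈p∪q⁺ (inj₂ (x∈p∪q⁺ (inj₂ x∈Z))))

  G-W⇒≢ : x ∈ G g → y ∈ W → x ≢ y
  G-W⇒≢ x∈G y∈W refl = G⇒∉W x∈G y∈W

  opaque
    W-or-G : ∀ x → x ∈ W ⊎ ∃[ g ] (x ∈ G g)
    W-or-G x with x ∈? W
    ... | yes x∈W = inj₁ x∈W
    ... | no  x∉W with x∈p∪q⁻ X (Y ∪ Z) (x∉∁p⇒x∈p x∉W)
    ...   | inj₁ x∈X = inj₂ (zero , x∈X)
    ...   | inj₂ x∈Y∪Z with x∈p∪q⁻ Y Z x∈Y∪Z
    ...     | inj₁ x∈Y = inj₂ (suc zero , x∈Y)
    ...     | inj₂ x∈Z = inj₂ (suc (suc zero) , x∈Z)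

  ∉W⇒∈G : x ∉ W → ∃[ g ] (x ∈ G g)
  ∉W⇒∈G {x = x} x∉W = [ (λ x∈W → ⊥-elim (x∉W x∈W)) , (λ x∈G → x∈G) ]′ (W-or-G x)

  another-group : (g : Fin 3) → ∃[ h ] (h ≢ g)
  another-group zero    = # 1 , λ ()
  another-group (suc _) = # 0 , λ ()

  ∣W∣≡3 : ∣ W ∣ ≡ 3
  ∣W∣≡3 = begin
    ∣ W ∣                          ≡⟨ ∣∁p∣≡n∸∣p∣ (X ∪ (Y ∪ Z)) ⟩
    21 ∸ ∣ X ∪ (Y ∪ Z) ∣           ≡⟨ cong (21 ∸_) (∣p∪q∣≡∣p∣+∣q∣ X (Y ∪ Z) X∩[Y∪Z]≡∅) ⟩
    21 ∸ (∣ X ∣ + ∣ Y ∪ Z ∣)        ≡⟨ cong (λ n → 21 ∸ (∣ X ∣ + n)) (∣p∪q∣≡∣p∣+∣q∣ Y Z (G-disjoint {# 1} {# 2} λ ())) ⟩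
    21 ∸ (∣ X ∣ + (∣ Y ∣ + ∣ Z ∣))  ≡⟨ cong₂ (λ m n → 21 ∸ (m + n)) (∣G∣≡6 (# 0)) (cong₂ _+_ (∣G∣≡6 (# 1)) (∣G∣≡6 (# 2))) ⟩
    3                              ∎
    where
    open ≡-Reasoning
    X∩[Y∪Z]≡∅ : x ∈ X → x ∉ Y ∪ Z
    X∩[Y∪Z]≡∅ x∈X x∈Y∪Z =
      [ G-disjoint {# 0} {# 1} (λ ()) x∈X , G-disjoint {# 0} {# 2} (λ ()) x∈X ]′ (x∈p∪q⁻ Y Z x∈Y∪Z)

  ∣G∪W∣≡9 : ∀ g → ∣ G g ∪ W ∣ ≡ 9
  ∣G∪W∣≡9 g = trans (∣p∪q∣≡∣p∣+∣q∣ (G g) W G⇒∉W) (cong₂ _+_ (∣G∣≡6 g) ∣W∣≡3)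

  ∣G─block∣≡3 : b ∈ₗ 𝓑 → b ⊆ G g → ∣ G g ─ b ∣ ≡ 3
  ∣G─block∣≡3 {b} {g} b∈𝓑 b⊆G = +-cancelʳ-≡ 3 ∣ G g ─ b ∣ 3 (begin
    ∣ G g ─ b ∣ + 3       ≡⟨ cong (∣ G g ─ b ∣ +_) (sym (∣b∣≡3 b∈𝓑)) ⟩
    ∣ G g ─ b ∣ + ∣ b ∣   ≡⟨ sym (q⊆p⇒∣p∣≡∣p─q∣+∣q∣ (G g) b b⊆G) ⟩
    ∣ G g ∣               ≡⟨ ∣G∣≡6 g ⟩
    6                     ∎)
    where open ≡-Reasoning

  T-OneIn : ∀ {t} → t ∈ₗ T → ∀ g → ∃[ x ] (x ∈ t × x ∈ G g × (∀ y → y ∈ t → y ∈ G g → y ≡ x))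
  T-OneIn t∈T zero             = let _ , _ , _ , _ , _ , _ , _ , T-blocks , _ = td
                                     _ , in-X , _ = All.lookup T-blocks t∈T in in-X
  T-OneIn t∈T (suc zero)       = let _ , _ , _ , _ , _ , _ , _ , T-blocks , _ = td
                                     _ , _ , in-Y , _ = All.lookup T-blocks t∈T in in-Y
  T-OneIn t∈T (suc (suc zero)) = let _ , _ , _ , _ , _ , _ , _ , T-blocks , _ = td
                                     _ , _ , _ , in-Z = All.lookup T-blocks t∈T in in-Z

  T-unique-point : ∀ {t} → t ∈ₗ T → x ∈ t → y ∈ t → x ∈ G g → y ∈ G g → x ≡ y
  T-unique-point {g = g} t∈T x∈t y∈t x∈G y∈G =
    let _ , _ , _ , unique = T-OneIn t∈T g in trans (unique _ x∈t x∈G) (sym (unique _ y∈t y∈G))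

  T-avoids-W : ∀ {t} → t ∈ₗ T → x ∈ t → x ∉ W
  T-avoids-W t∈T x∈t with x₀ , x₀∈t , x₀∈X , _ ← T-OneIn t∈T (# 0)
                        | x₁ , x₁∈t , x₁∈Y , _ ← T-OneIn t∈T (# 1)
                        | x₂ , x₂∈t , x₂∈Z , _ ← T-OneIn t∈T (# 2)
    with ∣p∣≡3⇒⊆⁅x,y,z⁆ (∣b∣≡3 (All.lookup T⊆𝓑 t∈T)) x₀∈t x₁∈t x₂∈t
           (G≢G⇒≢ {# 0} {# 1} (λ ()) x₀∈X x₁∈Y) (G≢G⇒≢ {# 0} {# 2} (λ ()) x₀∈X x₂∈Z)
           (G≢G⇒≢ {# 1} {# 2} (λ ()) x₁∈Y x₂∈Z) x∈t
  ... | inj₁ refl        = G⇒∉W x₀∈X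
  ... | inj₂ (inj₁ refl) = G⇒∉W x₁∈Y
  ... | inj₂ (inj₂ refl) = G⇒∉W x₂∈Z

  two-groups⇒∈T : b ∈ₗ 𝓑 → g ≢ h → x ∈ b → x ∈ G g → y ∈ b → y ∈ G h → b ∈ₗ T
  two-groups⇒∈T {g = g} {h = h} {x = x} {y = y} b∈𝓑 g≢h x∈b x∈G y∈b y∈G =
    let _ , _ , _ , _ , _ , _ , _ , _ , T-covers = td
        t , t∈T , x∈t , y∈t , _ = T-covers x y (different-groups g h g≢h x∈G y∈G)
    in subst (_∈ₗ T) (block-unique (All.lookup T⊆𝓑 t∈T) b∈𝓑 (G≢G⇒≢ g≢h x∈G y∈G) x∈t y∈t x∈b y∈b) t∈T
    where
    different-groups : ∀ g h → g ≢ h → x ∈ G g → y ∈ G h →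
      (x ∈ X × y ∈ Y) ⊎ (x ∈ Y × y ∈ X) ⊎ (x ∈ X × y ∈ Z) ⊎
      (x ∈ Z × y ∈ X) ⊎ (x ∈ Y × y ∈ Z) ⊎ (x ∈ Z × y ∈ Y)
    different-groups zero             zero             g≢h _ _ = ⊥-elim (g≢h refl)
    different-groups zero             (suc zero)       _ x∈ y∈ = inj₁ (x∈ , y∈)
    different-groups zero             (suc (suc zero)) _ x∈ y∈ = inj₂ (inj₂ (inj₁ (x∈ , y∈)))
    different-groups (suc zero)       zero             _ x∈ y∈ = inj₂ (inj₁ (x∈ , y∈))
    different-groups (suc zero)       (suc zero)       g≢h _ _ = ⊥-elim (g≢h refl)
    different-groups (suc zero)       (suc (suc zero)) _ x∈ y∈ = inj₂ (inj₂ (inj₂ (inj₂ (inj₁ (x∈ , y∈)))))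
    different-groups (suc (suc zero)) zero             _ x∈ y∈ = inj₂ (inj₂ (inj₂ (inj₁ (x∈ , y∈))))
    different-groups (suc (suc zero)) (suc zero)       _ x∈ y∈ = inj₂ (inj₂ (inj₂ (inj₂ (inj₂ (x∈ , y∈)))))
    different-groups (suc (suc zero)) (suc (suc zero)) g≢h _ _ = ⊥-elim (g≢h refl)

  ·∈W⊎G : x ∈ W ⊎ x ∈ G g → y ∈ G g → x ≢ y → x · y ∈ W ⊎ x · y ∈ G g
  ·∈W⊎G {x = x} {g = g} {y = y} x∈W⊎G y∈G x≢y with W-or-G (x · y)
  ... | inj₁ x·y∈W = inj₁ x·y∈W
  ... | inj₂ (h , x·y∈G′) with h ≟ g
  ...   | yes refl = inj₂ x·y∈G′
  ...   | no  h≢g =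
    let _ , _ , b , b∈𝓑 , x∈b , y∈b , x·y∈b = ·-line x≢y
        b∈T = two-groups⇒∈T b∈𝓑 h≢g x·y∈b x·y∈G′ y∈b y∈G
    in ⊥-elim ([ T-avoids-W b∈T x∈b , (λ x∈G → x≢y (T-unique-point b∈T x∈b y∈b x∈G y∈G)) ]′ x∈W⊎G)

  module _ (resolution : Resolvable 𝓑) {β : Subset 21} (β∈𝓑 : β ∈ₗ 𝓑) where

    open ParallelClasses resolution
    open Class β∈𝓑

    transversal-pigeonhole : ∀ {A B : Subset 21} {h₀ g₀} → A ⊆ G h₀ →
      (∀ {y} → y ∈ A → through y ∈ₗ T) →
      (∀ {x y} → y ∈ A → x ∈ through y → x ∈ G g₀ → x ∈ B) →
      ∣ A ∣ ≡ suc k → ∣ B ∣ ≡ k → ⊥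
    transversal-pigeonhole {A = A} {g₀ = g₀} A⊆G A-T into-B ∣A∣≡1+k ∣B∣≡k =
      pigeonhole ∣A∣≡1+k ∣B∣≡k meet (λ y∈A → into-B y∈A (meet∈through y∈A) (meet∈G y∈A)) meet-injective
      where
      meet : ∀ {y} → y ∈ A → Fin 21
      meet y∈A = proj₁ (T-OneIn (A-T y∈A) g₀)
      meet∈through : ∀ {y} (y∈A : y ∈ A) → meet y∈A ∈ through y
      meet∈through y∈A = let _ , x∈t , _ = T-OneIn (A-T y∈A) g₀ in x∈t
      meet∈G : ∀ {y} (y∈A : y ∈ A) → meet y∈A ∈ G g₀
      meet∈G y∈A = let _ , _ , x∈G , _ = T-OneIn (A-T y∈A) g₀ in x∈G
      meet-injective : ∀ {y y′} (y∈A : y ∈ A) (y′∈A : y′ ∈ A) → meet y∈A ≡ meet y′∈A → y ≡ y′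
      meet-injective {y} {y′} y∈A y′∈A meet≡ =
        T-unique-point (A-T y′∈A) (subst (y ∈_) same-block x∈through) x∈through (A⊆G y∈A) (A⊆G y′∈A)
        where
        same-block : through y ≡ through y′
        same-block = trans (sym (through-cong (meet∈through y∈A)))
                           (through-cong (subst (_∈ through y′) (sym meet≡) (meet∈through y′∈A)))

  record W≡⁅_,_,_⁆ (u v w : Fin 21) : Set where
    field
      u∈W : u ∈ W
      v∈W : v ∈ W
      w∈W : w ∈ W
      u≢v : u ≢ v
      u≢w : u ≢ w
      v≢w : v ≢ w

    W⊆⁅u,v,w⁆ : t ∈ W → t ≡ u ⊎ t ≡ v ⊎ t ≡ w
    W⊆⁅u,v,w⁆ = ∣p∣≡3⇒⊆⁅x,y,z⁆ ∣W∣≡3 u∈W v∈W w∈W u≢v u≢w v≢w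

  W-enumeration : ∃[ u ] ∃[ v ] ∃[ w ] W≡⁅ u , v , w ⁆
  W-enumeration =
    let u , u∈W = ∣p∣≡1+k⇒nonempty ∣W∣≡3
        v , v∈W , v≢u = ∣p∣≡2+k⇒second u∈W ∣W∣≡3
        w , w∈W , w≢u , w≢v = ∣p∣≡3⇒third ∣W∣≡3 u∈W v∈W (v≢u ∘ sym)
    in u , v , w , record { u∈W = u∈W ; v∈W = v∈W ; w∈W = w∈W
                          ; u≢v = v≢u ∘ sym ; u≢w = w≢u ∘ sym ; v≢w = w≢v ∘ sym }

  swap₁₂ : ∀ {u v w} → W≡⁅ u , v , w ⁆ → W≡⁅ v , u , w ⁆
  swap₁₂ e = record { u∈W = v∈W ; v∈W = u∈W ; w∈W = w∈W ; u≢v = u≢v ∘ sym ; u≢w = v≢w ; v≢w = u≢w }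
    where open W≡⁅_,_,_⁆ e

  rotate : ∀ {u v w} → W≡⁅ u , v , w ⁆ → W≡⁅ v , w , u ⁆
  rotate e = record { u∈W = v∈W ; v∈W = w∈W ; w∈W = u∈W ; u≢v = v≢w ; u≢w = u≢v ∘ sym ; v≢w = u≢w ∘ sym }
    where open W≡⁅_,_,_⁆ e

  module _ (b∈𝓑 : b ∈ₗ 𝓑) (W⊆b : W ⊆ b) where

    private
      W·W∈W : x ∈ W → y ∈ W → x ≢ y → x · y ∈ W
      W·W∈W x∈W y∈W x≢y with z , z∈W , z≢x , z≢y ← ∣p∣≡3⇒third ∣W∣≡3 x∈W y∈W x≢y
        with ∈⇒≡∨≡∨≡· b∈𝓑 (W⊆b x∈W) (W⊆b y∈W) x≢y (W⊆b z∈W)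
      ... | inj₁ z≡x          = ⊥-elim (z≢x z≡x)
      ... | inj₂ (inj₁ z≡y)   = ⊥-elim (z≢y z≡y)
      ... | inj₂ (inj₂ z≡x·y) = subst (_∈ W) z≡x·y z∈W

      G∪W-closed : ∀ g → x ∈ G g ∪ W → y ∈ G g ∪ W → x ≢ y → x · y ∈ G g ∪ W
      G∪W-closed g x∈ y∈ x≢y with x∈p∪q⁻ (G g) W x∈ | x∈p∪q⁻ (G g) W y∈
      ... | inj₂ x∈W | inj₂ y∈W = x∈p∪q⁺ (inj₂ (W·W∈W x∈W y∈W x≢y))
      ... | x∈G⊎W   | inj₁ y∈G = x∈p∪q⁺ (swap (·∈W⊎G (swap x∈G⊎W) y∈G x≢y))
      ... | inj₁ x∈G | inj₂ y∈W =
        subst (_∈ G g ∪ W) (·-comm (x≢y ∘ sym)) (x∈p∪q⁺ (swap (·∈W⊎G (inj₁ y∈W) x∈G (x≢y ∘ sym))))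

    G∪W-subSTS9 : ∀ g → IsSubSTS9 𝓑 (filter (_⊆? G g ∪ W) 𝓑)
    G∪W-subSTS9 g =
      All.tabulate (proj₁ ∘ ∈-filter⁻ (_⊆? G g ∪ W)) , G g ∪ W , ∣G∪W∣≡9 g , closed⇒IsSTSOn (G∪W-closed g)

  W⊈block : ExactlyOneSubSTS9 𝓑 → ∀ {b} → b ∈ₗ 𝓑 → ¬ W ⊆ b
  W⊈block (C , _ , C-unique) b∈𝓑 W⊆b =
    let x , x∈X = ∣p∣≡1+k⇒nonempty (∣G∣≡6 (# 0))
        w , w∈W = ∣p∣≡1+k⇒nonempty ∣W∣≡3
        X∪W-STS = G∪W-subSTS9 b∈𝓑 W⊆b (# 0)
        Y∪W-STS = G∪W-subSTS9 b∈𝓑 W⊆b (# 1)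
        _ , _ , _ , _ , _ , X∪W-covers = X∪W-STS
        b′ , b′∈C₀ , _ , x∈b′ , _ = X∪W-covers w x (x∈p∪q⁺ (inj₂ w∈W)) (x∈p∪q⁺ (inj₁ x∈X)) (G-W⇒≢ x∈X w∈W ∘ sym)
        b′∈C₁ = ∈-resp-↭ (↭-sym (C-unique _ Y∪W-STS)) (∈-resp-↭ (C-unique _ X∪W-STS) b′∈C₀)
    in [ G-disjoint {# 0} {# 1} (λ ()) x∈X , G⇒∉W x∈X ]′
         (x∈p∪q⁻ Y W (proj₂ (∈-filter⁻ (_⊆? Y ∪ W) {xs = 𝓑} b′∈C₁) x∈b′))

  module _ (W⊈blocks : ∀ {b} → b ∈ₗ 𝓑 → ¬ W ⊆ b) where

    third-∉ : ∀ {u v w} → W≡⁅ u , v , w ⁆ → b ∈ₗ 𝓑 → u ∈ b → v ∈ b → w ∉ b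
    third-∉ {b = b} e b∈𝓑 u∈b v∈b w∈b = W⊈blocks b∈𝓑 W⊆b
      where
      open W≡⁅_,_,_⁆ e
      W⊆b : W ⊆ b
      W⊆b t∈W with W⊆⁅u,v,w⁆ t∈W
      ... | inj₁ refl        = u∈b
      ... | inj₂ (inj₁ refl) = v∈b
      ... | inj₂ (inj₂ refl) = w∈b

    W·W∉W : x ∈ W → y ∈ W → x ≢ y → x · y ∉ W
    W·W∉W x∈W y∈W x≢y x·y∈W =
      let _ , _ , _ , b∈𝓑 , x∈b , y∈b , x·y∈b = ·-line x≢y
      in third-∉ (record { u∈W = x∈W ; v∈W = y∈W ; w∈W = x·y∈W
                         ; u≢v = x≢y ; u≢w = ·≢ˡ x≢y ∘ sym ; v≢w = ·≢ʳ x≢y ∘ sym })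
                 b∈𝓑 x∈b y∈b x·y∈b

    -- Otherwise x ↦ u · x would be a fixed-point-free involution of the five points G g - u · v.
    W·W-parity : ∀ {u v w} → W≡⁅ u , v , w ⁆ → u · v ∈ G g → u · w ∈ G g
    W·W-parity {g} {u} {v} {w} e u·v∈G with u · w ∈? G g
    ... | yes u·w∈G = u·w∈G
    ... | no  u·w∉G = ⊥-elim (from-no (2 ∣? 5)
                        (subst (2 ∣_) (∣p-x∣≡k u·v∈G (∣G∣≡6 g)) (involution⇒2∣∣p∣ (u ·_) u·∈ u·x≢x u·u·x≡x)))
      where
      open W≡⁅_,_,_⁆ e
      u≢ : x ∈ G g → u ≢ x
      u≢ x∈G = G-W⇒≢ x∈G u∈W ∘ sym
      u·x≢x : x ∈ G g - u · v → u · x ≢ x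
      u·x≢x x∈ = ·≢ʳ (u≢ (x∈p-y⇒x∈p x∈))
      u·u·x≡x : x ∈ G g - u · v → u · (u · x) ≡ x
      u·u·x≡x x∈ = ·-involutive (u≢ (x∈p-y⇒x∈p x∈))
      u·∈ : x ∈ G g - u · v → u · x ∈ G g - u · v
      u·∈ {x} x∈ with x∈G ← x∈p-y⇒x∈p {p = G g} x∈ with ·∈W⊎G (inj₁ u∈W) x∈G (u≢ x∈G)
      ... | inj₂ u·x∈G = x∈p∧x≢y⇒x∈p-y u·x∈G (G-W⇒≢ x∈G v∈W ∘ ·-cancelˡ (u≢ x∈G) u≢v)
      ... | inj₁ u·x∈W with W⊆⁅u,v,w⁆ u·x∈W
      ...   | inj₁ u·x≡u        = ⊥-elim (·≢ˡ (u≢ x∈G) u·x≡u)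
      ...   | inj₂ (inj₁ u·x≡v) = ⊥-elim (x∈p-y⇒x≢y x∈ (trans (sym (·-involutive (u≢ x∈G))) (cong (u ·_) u·x≡v)))
      ...   | inj₂ (inj₂ u·x≡w) =
        ⊥-elim (u·w∉G (subst (_∈ G g) (trans (sym (·-involutive (u≢ x∈G))) (cong (u ·_) u·x≡w)) x∈G))

    W·W-same-group : ∀ {u v w} → u ∈ W → v ∈ W → w ∈ W → u ≢ v → u ≢ w → u · v ∈ G g → u · w ∈ G g
    W·W-same-group {v = v} {w = w} u∈W v∈W w∈W u≢v u≢w u·v∈G with v ≟ w
    ... | yes refl = u·v∈G
    ... | no  v≢w  = W·W-parity (record { u∈W = u∈W ; v∈W = v∈W ; w∈W = w∈W
                                        ; u≢v = u≢v ; u≢w = u≢w ; v≢w = v≢w }) u·v∈G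

    W·W-all-in-group : ∀ {a b} → a ∈ W → b ∈ W → a ≢ b → a · b ∈ G g →
      ∀ {x y} → x ∈ W → y ∈ W → x ≢ y → x · y ∈ G g
    W·W-all-in-group {g} {a} a∈W b∈W a≢b a·b∈G {x} {y} x∈W y∈W x≢y with x ≟ a
    ... | yes refl = W·W-same-group a∈W b∈W y∈W a≢b x≢y a·b∈G
    ... | no  x≢a  = W·W-same-group x∈W a∈W y∈W x≢a x≢y
                       (subst (_∈ G g) (·-comm (x≢a ∘ sym)) (W·W-same-group a∈W b∈W x∈W a≢b (x≢a ∘ sym) a·b∈G))

    W·W-group : ∃[ g ] (∀ {x y} → x ∈ W → y ∈ W → x ≢ y → x · y ∈ G g)
    W·W-group =
      let _ , _ , _ , e = W-enumeration
          open W≡⁅_,_,_⁆ e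
          g , a·b∈G = ∉W⇒∈G (W·W∉W u∈W v∈W u≢v)
      in g , W·W-all-in-group u∈W v∈W u≢v a·b∈G

    module _ {g} (W·W∈G : ∀ {x y} → x ∈ W → y ∈ W → x ≢ y → x · y ∈ G g) {h} (h≢g : h ≢ g) where

      G·W∈G : y ∈ G h → w ∈ W → y · w ∈ G h
      G·W∈G {y} {w} y∈G w∈W with ·∈W⊎G (inj₁ w∈W) y∈G (G-W⇒≢ y∈G w∈W ∘ sym)
      ... | inj₂ w·y∈G = subst (_∈ G h) (·-comm (G-W⇒≢ y∈G w∈W ∘ sym)) w·y∈G
      ... | inj₁ w·y∈W = ⊥-elim (G-disjoint h≢g y∈G
              (subst (_∈ G g) (·-involutive w≢y) (W·W∈G w∈W w·y∈W (·≢ˡ w≢y ∘ sym))))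
        where
        w≢y : w ≢ y
        w≢y = G-W⇒≢ y∈G w∈W ∘ sym

      -- w ↦ y · w injects W into the two points of G h outside τ₁ other than s ∈ τ₂.
      G-blocks-disjoint : ∀ {τ₁ τ₂} → τ₁ ∈ₗ 𝓑 → τ₂ ∈ₗ 𝓑 → τ₁ ⊆ G h → τ₂ ⊆ G h → τ₁ ≢ τ₂ → y ∈ τ₁ → y ∉ τ₂
      G-blocks-disjoint {y} {τ₁} {τ₂} τ₁∈𝓑 τ₂∈𝓑 τ₁⊆G τ₂⊆G τ₁≢τ₂ y∈τ₁ y∈τ₂
        with s , s∈τ₂ , s≢y ← ∣p∣≡2+k⇒second y∈τ₂ (∣b∣≡3 τ₂∈𝓑) =
        pigeonhole ∣W∣≡3 (∣p-x∣≡k (x∈p∧x∉q⇒x∈p─q (τ₂⊆G s∈τ₂) s∉τ₁) (∣G─block∣≡3 τ₁∈𝓑 τ₁⊆G))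
          (λ {w} _ → y · w)
          (λ w∈W → x∈p∧x≢y⇒x∈p-y (x∈p∧x∉q⇒x∈p─q (G·W∈G (τ₁⊆G y∈τ₁) w∈W) (y·w∉ τ₁∈𝓑 τ₁⊆G y∈τ₁ w∈W))
                     (λ y·w≡s → y·w∉ τ₂∈𝓑 τ₂⊆G y∈τ₂ w∈W (subst (_∈ τ₂) (sym y·w≡s) s∈τ₂)))
          (λ w∈W w′∈W → ·-cancelˡ (y≢ w∈W) (y≢ w′∈W))
        where
        s∉τ₁ : s ∉ τ₁
        s∉τ₁ s∈τ₁ = τ₁≢τ₂ (block-unique τ₁∈𝓑 τ₂∈𝓑 (s≢y ∘ sym) y∈τ₁ s∈τ₁ y∈τ₂ s∈τ₂)
        y≢ : w ∈ W → y ≢ w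
        y≢ w∈W = G-W⇒≢ (τ₁⊆G y∈τ₁) w∈W
        y·w∉ : ∀ {τ} → τ ∈ₗ 𝓑 → τ ⊆ G h → y ∈ τ → w ∈ W → y · w ∉ τ
        y·w∉ τ∈𝓑 τ⊆G y∈τ w∈W y·w∈τ = G⇒∉W (τ⊆G (·∈⇒∈ τ∈𝓑 y∈τ y·w∈τ (y≢ w∈W))) w∈W

      three-blocks-in-G⇒⊥ : ∀ {τ₁ τ₂ τ₃} → τ₁ ∈ₗ 𝓑 → τ₂ ∈ₗ 𝓑 → τ₃ ∈ₗ 𝓑 →
        τ₁ ⊆ G h → τ₂ ⊆ G h → τ₃ ⊆ G h → τ₁ ≢ τ₂ → τ₁ ≢ τ₃ → τ₂ ≢ τ₃ → ⊥
      three-blocks-in-G⇒⊥ {τ₁} {τ₂} {τ₃} τ₁∈𝓑 τ₂∈𝓑 τ₃∈𝓑 τ₁⊆G τ₂⊆G τ₃⊆G τ₁≢τ₂ τ₁≢τ₃ τ₂≢τ₃ =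
        from-no (9 ≤? 6) (subst₂ _≤_ ∣τ₁∪τ₂∪τ₃∣≡9 (∣G∣≡6 h) (p⊆q⇒∣p∣≤∣q∣ τ₁∪τ₂∪τ₃⊆G))
        where
        τ₂∩τ₃≡∅ : x ∈ τ₂ → x ∉ τ₃
        τ₂∩τ₃≡∅ = G-blocks-disjoint τ₂∈𝓑 τ₃∈𝓑 τ₂⊆G τ₃⊆G τ₂≢τ₃
        τ₁∩[τ₂∪τ₃]≡∅ : x ∈ τ₁ → x ∉ τ₂ ∪ τ₃
        τ₁∩[τ₂∪τ₃]≡∅ x∈τ₁ x∈τ₂∪τ₃ =
          [ G-blocks-disjoint τ₁∈𝓑 τ₂∈𝓑 τ₁⊆G τ₂⊆G τ₁≢τ₂ x∈τ₁ , G-blocks-disjoint τ₁∈𝓑 τ₃∈𝓑 τ₁⊆G τ₃⊆G τ₁≢τ₃ x∈τ₁ ]′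
            (x∈p∪q⁻ τ₂ τ₃ x∈τ₂∪τ₃)
        ∣τ₁∪τ₂∪τ₃∣≡9 : ∣ τ₁ ∪ (τ₂ ∪ τ₃) ∣ ≡ 9
        ∣τ₁∪τ₂∪τ₃∣≡9 = trans (∣p∪q∣≡∣p∣+∣q∣ τ₁ (τ₂ ∪ τ₃) τ₁∩[τ₂∪τ₃]≡∅)
          (cong₂ _+_ (∣b∣≡3 τ₁∈𝓑) (trans (∣p∪q∣≡∣p∣+∣q∣ τ₂ τ₃ τ₂∩τ₃≡∅) (cong₂ _+_ (∣b∣≡3 τ₂∈𝓑) (∣b∣≡3 τ₃∈𝓑))))
        τ₁∪τ₂∪τ₃⊆G : τ₁ ∪ (τ₂ ∪ τ₃) ⊆ G h
        τ₁∪τ₂∪τ₃⊆G x∈ = [ τ₁⊆G , (λ x∈τ₂∪τ₃ → [ τ₂⊆G , τ₃⊆G ]′ (x∈p∪q⁻ τ₂ τ₃ x∈τ₂∪τ₃)) ]′ (x∈p∪q⁻ τ₁ (τ₂ ∪ τ₃) x∈)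

      module _ (resolution : Resolvable 𝓑) where

        open ParallelClasses resolution

        module _ {β u v w} (β∈𝓑 : β ∈ₗ 𝓑) (u∈β : u ∈ β) (v∈β : v ∈ β) (e : W≡⁅ u , v , w ⁆)
                 (no-block-in-G : ∀ {τ} → τ ∈ₗ 𝓑 → cls τ ≡ cls β → ¬ τ ⊆ G h) where

          open Class β∈𝓑
          open W≡⁅_,_,_⁆ e

          private
            δ : Subset 21
            δ = through w

            s-exists : ∃[ s ] (s ∈ δ × s ≢ w)
            s-exists = ∣p∣≡2+k⇒second x∈through (∣b∣≡3 through∈𝓑)

            s : Fin 21
            s = proj₁ s-exists

            s∈δ : s ∈ δ
            s∈δ = proj₁ (proj₂ s-exists)

            w≢s : w ≢ s
            w≢s = proj₂ (proj₂ s-exists) ∘ sym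

          β-points : t ∈ β → t ≡ u ⊎ t ≡ v ⊎ t ≡ u · v
          β-points = ∈⇒≡∨≡∨≡· β∈𝓑 u∈β v∈β u≢v

          δ-points : t ∈ δ → t ≡ w ⊎ t ≡ s ⊎ t ≡ w · s
          δ-points = ∈⇒≡∨≡∨≡· through∈𝓑 x∈through s∈δ w≢s

          u·v∈G : u · v ∈ G g
          u·v∈G = W·W∈G u∈W v∈W u≢v

          β≢δ : β ≢ δ
          β≢δ β≡δ = third-∉ e β∈𝓑 u∈β v∈β (subst (w ∈_) (sym β≡δ) x∈through)

          δ∩W⊆⁅w⁆ : t ∈ δ → t ∈ W → t ≡ w
          δ∩W⊆⁅w⁆ {t} t∈δ t∈W with W⊆⁅u,v,w⁆ t∈W
          ... | inj₁ refl        = ⊥-elim (β≢δ (trans (through-unique β∈𝓑 refl u∈β) (through-cong t∈δ)))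
          ... | inj₂ (inj₁ refl) = ⊥-elim (β≢δ (trans (through-unique β∈𝓑 refl v∈β) (through-cong t∈δ)))
          ... | inj₂ (inj₂ t≡w)  = t≡w

          s∉W : s ∉ W
          s∉W s∈W = w≢s (sym (δ∩W⊆⁅w⁆ s∈δ s∈W))

          private
            h₁ : Fin 3
            h₁ = proj₁ (∉W⇒∈G s∉W)

            s∈G₁ : s ∈ G h₁
            s∈G₁ = proj₂ (∉W⇒∈G s∉W)

          w·s∈G₁ : w · s ∈ G h₁
          w·s∈G₁ with ·∈W⊎G (inj₁ w∈W) s∈G₁ w≢s
          ... | inj₂ w·s∈G = w·s∈G
          ... | inj₁ w·s∈W = ⊥-elim (·≢ˡ w≢s (δ∩W⊆⁅w⁆ (·∈ through∈𝓑 x∈through s∈δ w≢s) w·s∈W))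

          G∉β : y ∈ G h → y ∉ β
          G∉β y∈G y∈β with β-points y∈β
          ... | inj₁ refl        = G⇒∉W y∈G u∈W
          ... | inj₂ (inj₁ refl) = G⇒∉W y∈G v∈W
          ... | inj₂ (inj₂ refl) = G-disjoint h≢g y∈G u·v∈G

          G∉δ : ∀ {h₀} → h₁ ≢ h₀ → y ∈ G h₀ → y ∉ δ
          G∉δ h₁≢h₀ y∈G y∈δ with δ-points y∈δ
          ... | inj₁ refl        = G⇒∉W y∈G w∈W
          ... | inj₂ (inj₁ refl) = G-disjoint h₁≢h₀ s∈G₁ y∈G
          ... | inj₂ (inj₂ refl) = G-disjoint h₁≢h₀ w·s∈G₁ y∈G

          through≡β : t ∈ β → t ∈ through y → through y ≡ β
          through≡β t∈β t∈through = trans (sym (through-cong t∈through)) (sym (through-unique β∈𝓑 refl t∈β))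

          through≡δ : t ∈ δ → t ∈ through y → through y ≡ δ
          through≡δ t∈δ t∈through = trans (sym (through-cong t∈through)) (through-cong t∈δ)

          through-∈T : ∀ {h₀} → y ∈ G h₀ → y ∉ β → y ∉ δ → ¬ through y ⊆ G h₀ → through y ∈ₗ T
          through-∈T {y} {h₀} y∈G y∉β y∉δ through⊈G with z , z∈through , z∉G ← p⊈q⇒∃∉ through⊈G with W-or-G z
          ... | inj₂ (h′ , z∈G′) =
            two-groups⇒∈T through∈𝓑 (λ h₀≡h′ → z∉G (subst (λ h → z ∈ G h) (sym h₀≡h′) z∈G′)) x∈through y∈G z∈through z∈G′
          ... | inj₁ z∈W with W⊆⁅u,v,w⁆ z∈W
          ...   | inj₁ refl        = ⊥-elim (y∉β (subst (y ∈_) (through≡β u∈β z∈through) x∈through))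
          ...   | inj₂ (inj₁ refl) = ⊥-elim (y∉β (subst (y ∈_) (through≡β v∈β z∈through) x∈through))
          ...   | inj₂ (inj₂ refl) = ⊥-elim (y∉δ (subst (y ∈_) (through≡δ x∈through z∈through) x∈through))

          u·v∈β : u · v ∈ β
          u·v∈β = ·∈ β∈𝓑 u∈β v∈β u≢v

          δ-misses-G⇒⊥ : h₁ ≢ h → ⊥
          δ-misses-G⇒⊥ h₁≢h =
            transversal-pigeonhole resolution β∈𝓑 {A = G h} {B = G g - u · v} (λ y∈G → y∈G)
              (λ y∈G → through-∈T y∈G (G∉β y∈G) (G∉δ h₁≢h y∈G) (no-block-in-G through∈𝓑 cls-through))
              (λ {x} {y} y∈G x∈through-y x∈G → x∈p∧x≢y⇒x∈p-y x∈G λ x≡u·v →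
                G∉β y∈G (subst (y ∈_) (through≡β (subst (_∈ β) (sym x≡u·v) u·v∈β) x∈through-y) x∈through))
              (∣G∣≡6 h) (∣p-x∣≡k u·v∈G (∣G∣≡6 g))

          w·s∈δ : w · s ∈ δ
          w·s∈δ = ·∈ through∈𝓑 x∈through s∈δ w≢s

          module _ (h₁≡h : h₁ ≡ h) where

            private
              s∈G : s ∈ G h
              s∈G = subst (λ h → s ∈ G h) h₁≡h s∈G₁

              w·s∈G : w · s ∈ G h
              w·s∈G = subst (λ h → w · s ∈ G h) h₁≡h w·s∈G₁

              h₁≢g : h₁ ≢ g
              h₁≢g h₁≡g = h≢g (trans (sym h₁≡h) h₁≡g)

              ∣G-s-w·s∣≡4 : ∣ G h - s - w · s ∣ ≡ 4
              ∣G-s-w·s∣≡4 = ∣p-x∣≡k (x∈p∧x≢y⇒x∈p-y w·s∈G (·≢ʳ w≢s)) (∣p-x∣≡k s∈G (∣G∣≡6 h))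

              Gh⊆G : y ∈ G h - s - w · s → y ∈ G h
              Gh⊆G = x∈p-y⇒x∈p ∘ x∈p-y⇒x∈p

              Gh∉δ : y ∈ G h - s - w · s → y ∉ δ
              Gh∉δ y∈A y∈δ with δ-points y∈δ
              ... | inj₁ refl         = G⇒∉W (Gh⊆G y∈A) w∈W
              ... | inj₂ (inj₁ y≡s)   = x∈p-y⇒x≢y (x∈p-y⇒x∈p y∈A) y≡s
              ... | inj₂ (inj₂ y≡w·s) = x∈p-y⇒x≢y y∈A y≡w·s

              Gg∉β : x ∈ G g - u · v → x ∉ β
              Gg∉β x∈A x∈β with β-points x∈β
              ... | inj₁ refl         = G⇒∉W (x∈p-y⇒x∈p x∈A) u∈W
              ... | inj₂ (inj₁ refl)  = G⇒∉W (x∈p-y⇒x∈p x∈A) v∈W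
              ... | inj₂ (inj₂ x≡u·v) = x∈p-y⇒x≢y x∈A x≡u·v

              through-Gg∌δ : x ∈ G g - u · v → t ∈ through x → t ∉ δ
              through-Gg∌δ {x} x∈A t∈through t∈δ =
                G∉δ h₁≢g (x∈p-y⇒x∈p x∈A) (subst (x ∈_) (through≡δ t∈δ t∈through) x∈through)

            -- Either the class has a block inside G g, which the transversal blocks through
            -- G h - s - w · s avoid, or every point of G g - u · v lies on a transversal block.
            δ-meets-G⇒⊥ : ⊥
            δ-meets-G⇒⊥ with ∃? (λ x → x ∈? G g - u · v ×-dec through x ⊆? G g)
            ... | yes (x₀ , _ , through-x₀⊆G) =
              transversal-pigeonhole resolution β∈𝓑 {A = G h - s - w · s} {B = G g ─ through x₀} Gh⊆G
                (λ y∈A → through-∈T (Gh⊆G y∈A) (G∉β (Gh⊆G y∈A)) (Gh∉δ y∈A) (no-block-in-G through∈𝓑 cls-through))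
                (λ {x} {y} y∈A x∈through-y x∈G → x∈p∧x∉q⇒x∈p─q x∈G λ x∈through-x₀ →
                  G-disjoint h≢g (Gh⊆G y∈A) (through-x₀⊆G (subst (y ∈_)
                    (trans (sym (through-cong x∈through-y)) (through-cong x∈through-x₀)) x∈through)))
                ∣G-s-w·s∣≡4 (∣G─block∣≡3 through∈𝓑 through-x₀⊆G)
            ... | no ∄x₀ =
              transversal-pigeonhole resolution β∈𝓑 {A = G g - u · v} {B = G h - s - w · s} x∈p-y⇒x∈p
                (λ x∈A → through-∈T (x∈p-y⇒x∈p x∈A) (Gg∉β x∈A) (G∉δ h₁≢g (x∈p-y⇒x∈p x∈A))
                                      (λ through⊆G → ∄x₀ (_ , x∈A , through⊆G)))
                (λ {y} {x} x∈A y∈through-x y∈G → x∈p∧x≢y⇒x∈p-y (x∈p∧x≢y⇒x∈p-y y∈G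
                   (λ y≡s → through-Gg∌δ x∈A (subst (_∈ through x) y≡s y∈through-x) s∈δ))
                   (λ y≡w·s → through-Gg∌δ x∈A (subst (_∈ through x) y≡w·s y∈through-x) w·s∈δ))
                (∣p-x∣≡k u·v∈G (∣G∣≡6 g)) ∣G-s-w·s∣≡4

          no-block-in-G⇒⊥ : ⊥
          no-block-in-G⇒⊥ with h₁ ≟ h
          ... | yes h₁≡h = δ-meets-G⇒⊥ h₁≡h
          ... | no  h₁≢h = δ-misses-G⇒⊥ h₁≢h

        class-has-block-in-G : ∀ {β u v w} → β ∈ₗ 𝓑 → u ∈ β → v ∈ β → W≡⁅ u , v , w ⁆ →
          ∃[ τ ] (τ ∈ₗ 𝓑 × cls τ ≡ cls β × τ ⊆ G h)
        class-has-block-in-G {β} β∈𝓑 u∈β v∈β e with any? (λ τ → (cls τ ≟ℕ cls β) ×-dec (τ ⊆? G h)) 𝓑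
        ... | yes ∃τ = find ∃τ
        ... | no  ∄τ = ⊥-elim (no-block-in-G⇒⊥ β∈𝓑 u∈β v∈β e (λ τ∈𝓑 cls≡ τ⊆G → ∄τ (lose τ∈𝓑 (cls≡ , τ⊆G))))

        W-lines-in-different-classes : ∀ {β β′ u v w} → W≡⁅ u , v , w ⁆ → β ∈ₗ 𝓑 → β′ ∈ₗ 𝓑 →
          u ∈ β → v ∈ β → u ∈ β′ → w ∈ β′ → cls β ≢ cls β′
        W-lines-in-different-classes e β∈𝓑 β′∈𝓑 u∈β v∈β u∈β′ w∈β′ cls≡ =
          third-∉ e β∈𝓑 u∈β v∈β (subst (_ ∈_) (sym (same-class⇒≡ β∈𝓑 β′∈𝓑 cls≡ u∈β u∈β′)) w∈β′)

        not-resolvable : ⊥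
        not-resolvable =
          let _ , _ , _ , e = W-enumeration
              open W≡⁅_,_,_⁆ e
              _ , _ , β₁ , β₁∈𝓑 , a∈β₁ , b∈β₁ , _ = ·-line u≢v
              _ , _ , β₂ , β₂∈𝓑 , a∈β₂ , c∈β₂ , _ = ·-line u≢w
              _ , _ , β₃ , β₃∈𝓑 , b∈β₃ , c∈β₃ , _ = ·-line v≢w
              τ₁ , τ₁∈𝓑 , cls-τ₁ , τ₁⊆G = class-has-block-in-G β₁∈𝓑 a∈β₁ b∈β₁ e
              τ₂ , τ₂∈𝓑 , cls-τ₂ , τ₂⊆G = class-has-block-in-G β₂∈𝓑 a∈β₂ c∈β₂ (swap₁₂ (rotate (rotate e)))
              τ₃ , τ₃∈𝓑 , cls-τ₃ , τ₃⊆G = class-has-block-in-G β₃∈𝓑 b∈β₃ c∈β₃ (rotate e)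
              different : ∀ {τ τ′ β β′} → cls τ ≡ cls β → cls τ′ ≡ cls β′ → cls β ≢ cls β′ → τ ≢ τ′
              different cls-τ cls-τ′ cls-β≢ τ≡τ′ = cls-β≢ (trans (sym cls-τ) (trans (cong cls τ≡τ′) cls-τ′))
          in three-blocks-in-G⇒⊥ τ₁∈𝓑 τ₂∈𝓑 τ₃∈𝓑 τ₁⊆G τ₂⊆G τ₃⊆G
               (different cls-τ₁ cls-τ₂ (W-lines-in-different-classes e β₁∈𝓑 β₂∈𝓑 a∈β₁ b∈β₁ a∈β₂ c∈β₂))
               (different cls-τ₁ cls-τ₃ (W-lines-in-different-classes (swap₁₂ e) β₁∈𝓑 β₃∈𝓑 b∈β₁ a∈β₁ b∈β₃ c∈β₃))
               (different cls-τ₂ cls-τ₃ (W-lines-in-different-classes (rotate (rotate e)) β₂∈𝓑 β₃∈𝓑 c∈β₂ a∈β₂ c∈β₃ b∈β₃))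

proposition5 : (𝓑 : List (Subset 21)) → IsSTS 21 𝓑 → HasSubTD36 𝓑 →
    ExactlyOneSubSTS9 𝓑 → ¬ Resolvable 𝓑
proposition5 𝓑 sts (X , Y , Z , T , T⊆𝓑 , td) one-sub-STS9 resolution =
  let open Configuration sts T⊆𝓑 td
      W⊈blocks = W⊈block one-sub-STS9
      g , W·W∈G = W·W-group W⊈blocks
      h , h≢g = another-group g
  in not-resolvable W⊈blocks W·W∈G h≢g resolution
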